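{- Let $G=(V,E)$ be a finite graph, let $n_v\in\mathbb{Z}^+$ for each $v\in V$, let $G_v=\overline{K_{3n_v}}$ (the edgeless graph on $3n_v$ vertices), and let $\mathcal{G}=\{G_v : v\in V\}$ (taken pairwise vertex-disjoint). Then the join of $\mathcal{G}$ along $G$, $\nabla\mathcal{G}$, is 3-balanced.
   Context: For a graph $G=(V,E)$ and a collection $\mathcal{G}=\{G_v : v\in V\}$ of pairwise disjoint graphs indexed by $V$, the join of $\mathcal{G}$ along $G$, $\nabla\mathcal{G}$, is the graph obtained from the disjoint union $\bigcup_{v\in V}G_v$ by adding, for every edge $vw\in E$, all possible edges between vertices of $G_v$ and vertices of $G_w$. A graph is 3-balanced if it admits a vertex coloring $\ell:V\to\mathbb{Z}_3$ such that every vertex has, in its open neighborhood, the same number of vertices of each of the three colors. -}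

module Defs where

open import Data.Nat using (ℕ; zero; suc; _*_)
open import Data.Fin using (Fin; _≟_)
open import Data.Bool using (Bool; true; false; _∧_; _∨_)
open import Data.Product using (Σ; _,_)
open import Data.List using (List; length; filterᵇ; allFin; concatMap; map)
open import Relation.Binary.PropositionalEquality using (_≡_; refl; subst)
open import Relation.Nullary.Decidable using (does; yes; no)
open import Data.Fin.Properties using () renaming (_≟_ to _≟F_)
open import Relation.Nullary using (Dec)

record Graph (n : ℕ) : Set where
  field
    adj    : Fin n → Fin n → Bool
    sym    : ∀ u v → adj u v ≡ adj v u
    irrefl : ∀ v → adj v v ≡ false
open Graph public

edgeless : (m : ℕ) → Graph m
edgeless m = record { adj = λ _ _ → false ; sym = λ _ _ → refl ; irrefl = λ _ → refl }

JoinVtx : (k : ℕ) → (m : Fin k → ℕ) → Set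
JoinVtx k m = Σ (Fin k) (λ v → Fin (m v))

joinVerts : (k : ℕ) (m : Fin k → ℕ) → List (JoinVtx k m)
joinVerts k m = concatMap (λ v → map (λ i → (v , i)) (allFin (m v))) (allFin k)

sameBlockAdj : ∀ {k} (m : Fin k → ℕ) (H : (v : Fin k) → Graph (m v))
               (v w : Fin k) → Fin (m v) → Fin (m w) → Bool
sameBlockAdj m H v w i j with v ≟F w
... | yes refl = adj (H v) i j
... | no _     = false

joinAdj : ∀ {k} (G : Graph k) (m : Fin k → ℕ) (H : (v : Fin k) → Graph (m v))
          → JoinVtx k m → JoinVtx k m → Bool
joinAdj G m H (v , i) (w , j) = sameBlockAdj m H v w i j ∨ adj G v w

nbrCount : ∀ {k} (G : Graph k) (m : Fin k → ℕ) (H : (v : Fin k) → Graph (m v))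
           (ℓ : JoinVtx k m → Fin 3) (x : JoinVtx k m) (c : Fin 3) → ℕ
nbrCount G m H ℓ x c =
  length (filterᵇ (λ y → joinAdj G m H x y ∧ does (ℓ y ≟F c)) (joinVerts _ m))

-- The join is 3-balanced: there is a colouring ℓ into ℤ₃ (= Fin 3) such that
-- every vertex has equally many neighbours of each colour.
Join3Balanced : ∀ {k} (G : Graph k) (m : Fin k → ℕ) (H : (v : Fin k) → Graph (m v)) → Set
Join3Balanced {k} G m H =
  Σ (JoinVtx k m → Fin 3) λ ℓ →
    ∀ x (c d : Fin 3) → nbrCount G m H ℓ x c ≡ nbrCount G m H ℓ x d

{-# OPTIONS --safe #-}
-- Colour each block G_v = K̄_{3n_v} so that every colour occurs exactly n_v times
-- in it (split the block into three consecutive thirds). Since the blocks are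
-- edgeless, a vertex of block v sees precisely the blocks w adjacent to v in G,
-- each in its entirety, so it has Σ_{vw ∈ E} n_w neighbours of every colour.
module Submission where

open import Defs hiding (sym)
open import Data.Bool using (Bool; true; false; _∧_)
open import Data.Fin using (Fin; zero; suc; _↑ˡ_; _↑ʳ_; quotient)
open import Data.Fin.Properties using (_≟_; splitAt-↑ˡ; splitAt-↑ʳ)
open import Data.List using (List; []; _∷_; _++_; length; filterᵇ; map; concatMap; tabulate; allFin)
open import Data.List.Properties using (length-++; filter-++; map-cong; map-tabulate; length-tabulate)
open import Data.Nat using (ℕ; zero; suc; _+_; _*_; NonZero)
open import Data.Nat.ListAction using (sum)
open import Data.Nat.Properties using (+-identityʳ)
open import Data.Product using (_,_)
open import Function using (_∘_; id)
open import Relation.Binary.PropositionalEquality using (_≡_; refl; sym; trans; cong; cong₂; module ≡-Reasoning)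
open import Relation.Nullary.Decidable using (does; yes; no; T?)

open ≡-Reasoning

private variable
  A B : Set

count : (A → Bool) → List A → ℕ
count p xs = length (filterᵇ p xs)

count-cong : ∀ {p q : A → Bool} → (∀ x → p x ≡ q x) → ∀ xs → count p xs ≡ count q xs
count-cong p≗q []       = refl
count-cong {p = p} {q = q} p≗q (x ∷ xs) with p x | q x | p≗q x
... | true  | .true  | refl = cong suc (count-cong p≗q xs)
... | false | .false | refl = count-cong p≗q xs

count-true : ∀ (xs : List A) → count (λ _ → true) xs ≡ length xs
count-true []       = refl
count-true (x ∷ xs) = cong suc (count-true xs)

count-false : ∀ (xs : List A) → count (λ _ → false) xs ≡ 0
count-false []       = refl
count-false (x ∷ xs) = count-false xs

count-∧ˡ-cong : ∀ b {p q : A → Bool} xs → count p xs ≡ count q xs →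
                count (λ x → b ∧ p x) xs ≡ count (λ x → b ∧ q x) xs
count-∧ˡ-cong true  xs eq = eq
count-∧ˡ-cong false xs eq = refl

count-++ : ∀ (p : A → Bool) xs ys → count p (xs ++ ys) ≡ count p xs + count p ys
count-++ p xs ys = trans (cong length (filter-++ (T? ∘ p) xs ys)) (length-++ (filterᵇ p xs))

count-map : ∀ (p : A → Bool) (f : B → A) xs → count p (map f xs) ≡ count (p ∘ f) xs
count-map p f []       = refl
count-map p f (x ∷ xs) with p (f x)
... | true  = cong suc (count-map p f xs)
... | false = count-map p f xs

count-tabulate : ∀ {n} (p : A → Bool) (f : Fin n → A) → count p (tabulate f) ≡ count (p ∘ f) (allFin n)
count-tabulate p f = trans (cong (count p) (sym (map-tabulate id f))) (count-map p f (allFin _))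

count-concatMap : ∀ (p : A → Bool) (f : B → List A) xs →
                  count p (concatMap f xs) ≡ sum (map (count p ∘ f) xs)
count-concatMap p f []       = refl
count-concatMap p f (x ∷ xs) =
  trans (count-++ p (f x) (concatMap f xs)) (cong (count p (f x) +_) (count-concatMap p f xs))

tabulate-+ : ∀ m {n} (f : Fin (m + n) → A) →
             tabulate f ≡ tabulate (f ∘ (_↑ˡ n)) ++ tabulate (f ∘ (m ↑ʳ_))
tabulate-+ zero    f = refl
tabulate-+ (suc m) f = cong (f zero ∷_) (tabulate-+ m (f ∘ suc))

fibreSize : ∀ {m r} → (Fin m → Fin r) → Fin r → ℕ
fibreSize χ c = count (λ i → does (χ i ≟ c)) (allFin _)

Equitable : ∀ {m r} → (Fin m → Fin r) → Set
Equitable χ = ∀ c d → fibreSize χ c ≡ fibreSize χ d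

quotient-↑ˡ : ∀ {m} n (i : Fin n) → quotient {suc m} n (i ↑ˡ m * n) ≡ zero
quotient-↑ˡ {m} n i rewrite splitAt-↑ˡ n i (m * n) = refl

quotient-↑ʳ : ∀ {m} n (j : Fin (m * n)) → quotient {suc m} n (n ↑ʳ j) ≡ suc (quotient {m} n j)
quotient-↑ʳ {m} n j rewrite splitAt-↑ʳ n (m * n) j = refl

fibreSize-quotient-suc : ∀ m n (c : Fin (suc m)) →
  fibreSize (quotient {suc m} n) c ≡
  count (λ _ → does (zero ≟ c)) (allFin n) + count (λ j → does (suc (quotient n j) ≟ c)) (allFin (m * n))
fibreSize-quotient-suc m n c = begin
  count P (tabulate id)
    ≡⟨ cong (count P) (tabulate-+ n id) ⟩
  count P (tabulate (_↑ˡ m * n) ++ tabulate (n ↑ʳ_))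
    ≡⟨ count-++ P (tabulate (_↑ˡ m * n)) (tabulate (n ↑ʳ_)) ⟩
  count P (tabulate (_↑ˡ m * n)) + count P (tabulate (n ↑ʳ_))
    ≡⟨ cong₂ _+_ (count-tabulate P (_↑ˡ m * n)) (count-tabulate P (n ↑ʳ_)) ⟩
  count (P ∘ (_↑ˡ m * n)) (allFin n) + count (P ∘ (n ↑ʳ_)) (allFin (m * n))
    ≡⟨ cong₂ _+_ (count-cong (λ i → cong (λ q → does (q ≟ c)) (quotient-↑ˡ n i)) (allFin n))
                 (count-cong (λ j → cong (λ q → does (q ≟ c)) (quotient-↑ʳ n j)) (allFin (m * n))) ⟩
  count (λ _ → does (zero ≟ c)) (allFin n) + count (λ j → does (suc (quotient n j) ≟ c)) (allFin (m * n)) ∎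
  where
  P : Fin (suc m * n) → Bool
  P i = does (quotient n i ≟ c)

fibreSize-quotient : ∀ m n (c : Fin m) → fibreSize (quotient {m} n) c ≡ n
fibreSize-quotient (suc m) n zero = begin
  fibreSize (quotient {suc m} n) zero
    ≡⟨ fibreSize-quotient-suc m n zero ⟩
  count (λ _ → true) (allFin n) + count (λ _ → false) (allFin (m * n))
    ≡⟨ cong₂ _+_ (trans (count-true (allFin n)) (length-tabulate id)) (count-false (allFin (m * n))) ⟩
  n + 0
    ≡⟨ +-identityʳ n ⟩
  n ∎
fibreSize-quotient (suc m) n (suc c) = begin
  fibreSize (quotient {suc m} n) (suc c)
    ≡⟨ fibreSize-quotient-suc m n (suc c) ⟩
  count (λ _ → false) (allFin n) + fibreSize (quotient {m} n) c
    ≡⟨ cong (_+ fibreSize (quotient {m} n) c) (count-false (allFin n)) ⟩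
  fibreSize (quotient {m} n) c
    ≡⟨ fibreSize-quotient m n c ⟩
  n ∎

quotient-equitable : ∀ m n → Equitable (quotient {m} n)
quotient-equitable m n c d = trans (fibreSize-quotient m n c) (sym (fibreSize-quotient m n d))

joinAdj-edgeless : ∀ {k} (G : Graph k) (m : Fin k → ℕ) v i w j →
                   joinAdj G m (edgeless ∘ m) (v , i) (w , j) ≡ adj G v w
joinAdj-edgeless G m v i w j with v ≟ w
... | yes refl = refl
... | no _     = refl

edgelessJoin-3Balanced : ∀ {k} (G : Graph k) (m : Fin k → ℕ) (χ : ∀ v → Fin (m v) → Fin 3) →
                         (∀ v → Equitable (χ v)) → Join3Balanced G m (edgeless ∘ m)
edgelessJoin-3Balanced {k} G m χ χ-equitable = ℓ , balanced
  where
  ℓ : JoinVtx k m → Fin 3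
  ℓ (w , j) = χ w j

  blockCount : Fin k → Fin k → Fin 3 → ℕ
  blockCount v w c = count (λ j → adj G v w ∧ does (χ w j ≟ c)) (allFin (m w))

  nbrCount-blocks : ∀ v i c →
    nbrCount G m (edgeless ∘ m) ℓ (v , i) c ≡ sum (map (λ w → blockCount v w c) (allFin k))
  nbrCount-blocks v i c =
    trans (count-concatMap P _ (allFin k)) (cong sum (map-cong inBlock (allFin k)))
    where
    P : JoinVtx k m → Bool
    P y = joinAdj G m (edgeless ∘ m) (v , i) y ∧ does (ℓ y ≟ c)

    inBlock : ∀ w → count P (map (w ,_) (allFin (m w))) ≡ blockCount v w c
    inBlock w = trans (count-map P (w ,_) (allFin (m w)))
                      (count-cong (λ j → cong (_∧ does (χ w j ≟ c)) (joinAdj-edgeless G m v i w j))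
                                  (allFin (m w)))

  balanced : ∀ x c d → nbrCount G m (edgeless ∘ m) ℓ x c ≡ nbrCount G m (edgeless ∘ m) ℓ x d
  balanced (v , i) c d = begin
    nbrCount G m (edgeless ∘ m) ℓ (v , i) c    ≡⟨ nbrCount-blocks v i c ⟩
    sum (map (λ w → blockCount v w c) (allFin k))
      ≡⟨ cong sum (map-cong (λ w → count-∧ˡ-cong (adj G v w) (allFin (m w)) (χ-equitable w c d))
                            (allFin k)) ⟩
    sum (map (λ w → blockCount v w d) (allFin k)) ≡⟨ sym (nbrCount-blocks v i d) ⟩
    nbrCount G m (edgeless ∘ m) ℓ (v , i) d    ∎

theorem6p5 : (k : ℕ) (G : Graph k) (n : Fin k → ℕ)
    → (∀ v → NonZero (n v))
    → Join3Balanced G (λ v → 3 * n v) (λ v → edgeless (3 * n v))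
theorem6p5 k G n _ =
  edgelessJoin-3Balanced G (λ v → 3 * n v) (λ v → quotient (n v)) (λ v → quotient-equitable 3 (n v))
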